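{- Let $v$ and $k$ be integers with $2\le k<v$. There exists an $RB(v,k,1)$ if and only if there exists a $\mu$-way $1$-solely balanced set with block size $k$, volume $m=\frac{v}{k}$ and $\mu=\frac{v-1}{k-1}$.
   Context: An $RB(v,k,1)$ is a resolvable $2$-$(v,k,1)$ design: a collection $\mathcal B$ of $k$-subsets (blocks) of a $v$-set $\mathcal V$ such that every pair of points of $\mathcal V$ lies in exactly one block, and $\mathcal B$ can be partitioned into parallel classes, each parallel class being a set of pairwise disjoint blocks whose union is $\mathcal V$. For integers $\mu\ge 2$, $k>t\ge1$, a $\mu$-way $(v,k,t)$ trade of volume $m$ consists of $\mu$ pairwise disjoint collections $T_1,\dots,T_\mu$, each of $m$ blocks ($k$-subsets of a $v$-set $V$), such that every $t$-subset of $V$ is contained in the same number of blocks in each $T_i$. Its foundation $\mathrm{found}(T)$ is the set of points covered by the blocks. It is a Steiner trade if every $t$-subset of $\mathrm{found}(T)$ occurs in at most one block of each $T_i$. A $\mu$-way $t$-solely balanced set is a $\mu$-way $(v,k,t)$ Steiner trade $T=\{T_1,\dots,T_\mu\}$ such that no block of $T_j$ and block of $T_b$ with $j\neq b$ have more than $t$ common elements. Block size is $k$, volume is $m$, and foundation size is $|\mathrm{found}(T)|$. -}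

module Defs where

open import Data.Nat using (ℕ; suc; _+_; _*_; _∸_; _≤_; _<_)
open import Data.Fin using (Fin)
open import Data.Fin.Subset using (Subset; _∈_; _∩_; ∣_∣)
open import Data.Fin.Subset.Properties using (_∈?_)
open import Data.Vec using (tabulate)
open import Data.Product using (Σ; ∃; _×_; _,_)
open import Data.Empty using (⊥)
open import Relation.Nullary using (¬_; does)
open import Relation.Binary.PropositionalEquality using (_≡_; _≢_)

-- A collection of b blocks is an injective family Fin b → Subset v
-- (injectivity: the collection is a set of b distinct blocks).

InjectiveFamily : ∀ {b v} → (Fin b → Subset v) → Set
InjectiveFamily {b} B = ∀ (a a' : Fin b) → B a ≡ B a' → a ≡ a'

record RB (v k : ℕ) : Set where
  field
    numBlocks   : ℕ
    block       : Fin numBlocks → Subset v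
    distinct    : InjectiveFamily block
    blockSize   : ∀ a → ∣ block a ∣ ≡ k
    pairCovered : ∀ (x y : Fin v) → x ≢ y → ∃ λ a → x ∈ block a × y ∈ block a
    pairUnique  : ∀ (x y : Fin v) → x ≢ y → ∀ a a' →
                  x ∈ block a → y ∈ block a → x ∈ block a' → y ∈ block a' → a ≡ a'
    numClasses  : ℕ
    classOf     : Fin numBlocks → Fin numClasses
    classDisjoint : ∀ (a a' : Fin numBlocks) → classOf a ≡ classOf a' → a ≢ a' →
                    ∀ (x : Fin v) → x ∈ block a → x ∈ block a' → ⊥
    classCovers : ∀ (c : Fin numClasses) (x : Fin v) →
                  ∃ λ a → classOf a ≡ c × x ∈ block a

degree : ∀ {m n} → (Fin m → Subset n) → Fin n → ℕ
degree B x = ∣ tabulate (λ a → does (x ∈? B a)) ∣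

-- A μ-way 1-solely balanced set with block size k and volume m on the
-- point set Fin n (the ambient set V), with μ ≥ 2 and k > t = 1.
-- T i a is the a-th block of the i-th collection T_i.
record SolelyBalanced1 (μ k m n : ℕ) : Set where
  field
    twoWays       : 2 ≤ μ
    kGtT          : 1 < k
    T             : Fin μ → Fin m → Subset n
    blockSize     : ∀ i a → ∣ T i a ∣ ≡ k
    -- each T_i consists of m distinct blocks, and the T_i are pairwise disjoint
    distinct      : ∀ i j a b → T i a ≡ T j b → (i ≡ j × a ≡ b)
    balanced      : ∀ i j (x : Fin n) → degree (T i) x ≡ degree (T j) x
    steiner       : ∀ i (x : Fin n) a a' → x ∈ T i a → x ∈ T i a' → a ≡ a'
    solely        : ∀ j b → j ≢ b → ∀ a c → ∣ T j a ∩ T b c ∣ ≤ 1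

-- Both directions rest on one double count through a point x (module Pencil).
-- Let T be a μ-way family of k-blocks in which two distinct points share at
-- most one block, whose blocks lie in a point set p, and such that x lies in
-- exactly one block of every way.  Counting the incidences "y lies in a block
-- of the family together with x" gives μk in total, while each y ≠ x of p is
-- joined to x at most once.  Hence μk ≤ |p| + (μ-1), with equality iff x is
-- joined to every other point of p; equality is the identity μ(k-1) = v-1.
--
-- From a design, the parallel classes (each of the same size m = v/k) form
-- the ways of a solely balanced set, and the pencil identity yields μ(k-1) =
-- v-1.  From a solely balanced set, its foundation has mk = v points, the
-- identity forces every pair of foundation points to be covered, and the
-- blocks, grouped by way, form a resolvable design on the foundation, which
-- is finally transported to the point set Fin |foundation|.
module Submission where

open import Defs
open import Data.Nat using (ℕ; zero; suc; _+_; _*_; _∸_; _≤_; _<_; z≤n; s≤s; _≤?_; NonZero; >-nonZero⁻¹)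
open import Data.Nat.Properties
  using ( +-*-semiring; ≤-refl; ≤-trans; ≤-antisym; ≤-reflexive; +-mono-≤; +-monoʳ-≤
        ; m≤m+n; m≤n+m; m≤n+m∸n; m+[n∸m]≡n; +-cancelʳ-≤; +-cancelˡ-≡; +-comm
        ; +-identityʳ; *-identityˡ; *-identityʳ; *-zeroʳ; *-suc; *-cancelʳ-≡
        ; suc-injective; n<1⇒n≡0; ≰⇒>; <-irrefl; module ≤-Reasoning)
open import Data.Fin using (Fin; zero; suc; combine; remQuot)
open import Data.Fin.Properties using (_≟_; 0≢1+n; nonZeroIndex; remQuot-combine; combine-remQuot)
  renaming (suc-injective to sucᶠ-injective)
open import Data.Fin.Subset using (Subset; _∈_; _∩_; ∣_∣; _⊆_; ⊤)
open import Data.Fin.Subset.Properties using (_∈?_; ⊆-antisym; x∈p∩q⁺; x∈p∩q⁻; ∈⊤; ∣⊤∣≡n)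
open import Data.Vec using (_∷_; []; tabulate; here; there)
open import Data.Vec.Properties using (lookup⇒[]=; []=⇒lookup; lookup∘tabulate)
open import Data.Bool using (true; false; if_then_else_)
open import Data.Product using (∃; ∃₂; _×_; _,_; proj₁; proj₂; uncurry)
open import Data.Empty using (⊥)
open import Function using (_∘_)
open import Function.Bundles using (_⇔_; mk⇔; Equivalence)
open import Relation.Nullary using (¬_; Dec; yes; no; does; _×-dec_; contradiction)
open import Relation.Nullary.Decidable using (decidable-stable)
open import Relation.Binary.PropositionalEquality
open import Algebra.Properties.Semiring.Sum +-*-semiring
  using (sum; sum-syntax; sum-cong-≗; ∑-comm; ∑-distrib-+; *-distribˡ-sum; *-distribʳ-sum)

sum-const : ∀ n c → ∑[ i < n ] c ≡ n * c
sum-const zero    c = refl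
sum-const (suc n) c = cong (c +_) (sum-const n c)

sum-mono-≤ : ∀ {n} {f g : Fin n → ℕ} → (∀ i → f i ≤ g i) → sum f ≤ sum g
sum-mono-≤ {zero}  f≤g = z≤n
sum-mono-≤ {suc n} f≤g = +-mono-≤ (f≤g zero) (sum-mono-≤ (f≤g ∘ suc))

term≤sum : ∀ {n} (f : Fin n → ℕ) i → f i ≤ sum f
term≤sum f zero    = m≤m+n _ _
term≤sum f (suc i) = ≤-trans (term≤sum (f ∘ suc) i) (m≤n+m _ _)

positive-term : ∀ {n} (f : Fin n → ℕ) → 1 ≤ sum f → ∃ λ i → 1 ≤ f i
positive-term {suc n} f pos with 1 ≤? f zero
... | yes f₀>0 = zero , f₀>0
... | no  f₀≯0 with positive-term (f ∘ suc)
                      (subst (λ h → 1 ≤ h + sum (f ∘ suc)) (n<1⇒n≡0 (≰⇒> f₀≯0)) pos)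
...   | i , fᵢ>0 = suc i , fᵢ>0

AtMostOnePositive : ∀ {n} → (Fin n → ℕ) → Set
AtMostOnePositive f = ∀ i j → 1 ≤ f i → 1 ≤ f j → i ≡ j

sum≤1 : ∀ {n} (f : Fin n → ℕ) → (∀ i → f i ≤ 1) → AtMostOnePositive f → sum f ≤ 1
sum≤1 {zero}  f f≤1 unique = z≤n
sum≤1 {suc n} f f≤1 unique with 1 ≤? f zero
... | no f₀≯0 = subst (λ h → h + sum (f ∘ suc) ≤ 1) (sym (n<1⇒n≡0 (≰⇒> f₀≯0)))
                  (sum≤1 (f ∘ suc) (f≤1 ∘ suc) (λ i j fᵢ>0 fⱼ>0 → sucᶠ-injective
                                                   (unique (suc i) (suc j) fᵢ>0 fⱼ>0)))
... | yes f₀>0 = subst (λ h → f zero + h ≤ 1) (sym rest≡0)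
                   (≤-trans (≤-reflexive (+-identityʳ (f zero))) (f≤1 zero))
  where
  rest≡0 : sum (f ∘ suc) ≡ 0
  rest≡0 = trans (sum-cong-≗ (λ i → n<1⇒n≡0 (≰⇒> (λ fᵢ>0 →
                    0≢1+n (unique zero (suc i) f₀>0 fᵢ>0)))))
                 (trans (sum-const n 0) (*-zeroʳ n))

sum≤1⇒unique : ∀ {n} (f : Fin n → ℕ) → sum f ≤ 1 → AtMostOnePositive f
sum≤1⇒unique f s≤1 zero    zero    _    _    = refl
sum≤1⇒unique f s≤1 zero    (suc j) f₀>0 fⱼ>0 =
  contradiction (≤-trans (+-mono-≤ f₀>0 (≤-trans fⱼ>0 (term≤sum (f ∘ suc) j))) s≤1) λ { (s≤s ()) }
sum≤1⇒unique f s≤1 (suc i) zero    fᵢ>0 f₀>0 =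
  contradiction (≤-trans (+-mono-≤ f₀>0 (≤-trans fᵢ>0 (term≤sum (f ∘ suc) i))) s≤1) λ { (s≤s ()) }
sum≤1⇒unique f s≤1 (suc i) (suc j) fᵢ>0 fⱼ>0 =
  cong suc (sum≤1⇒unique (f ∘ suc) (≤-trans (m≤n+m _ _) s≤1) i j fᵢ>0 fⱼ>0)

sum-tight : ∀ {n} (f g : Fin n → ℕ) → (∀ i → f i ≤ g i) → sum f ≡ sum g → ∀ i → f i ≡ g i
sum-tight {suc n} f g f≤g eq = tight
  where
  head≡ : f zero ≡ g zero
  head≡ = ≤-antisym (f≤g zero)
    (+-cancelʳ-≤ (sum (f ∘ suc)) (g zero) (f zero)
      (≤-trans (+-monoʳ-≤ (g zero) (sum-mono-≤ (f≤g ∘ suc))) (≤-reflexive (sym eq))))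
  tight : ∀ i → f i ≡ g i
  tight zero    = head≡
  tight (suc i) = sum-tight (f ∘ suc) (g ∘ suc) (f≤g ∘ suc)
    (+-cancelˡ-≡ (f zero) _ _ (trans eq (cong (_+ sum (g ∘ suc)) (sym head≡)))) i

χ : ∀ {P : Set} → Dec P → ℕ
χ P? = if does P? then 1 else 0

module _ {P : Set} where

  χ≤1 : (P? : Dec P) → χ P? ≤ 1
  χ≤1 (yes _) = ≤-refl
  χ≤1 (no _)  = z≤n

  χ-yes : (P? : Dec P) → P → χ P? ≡ 1
  χ-yes (yes _) _  = refl
  χ-yes (no ¬p) p  = contradiction p ¬p

  χ-no : (P? : Dec P) → ¬ P → χ P? ≡ 0
  χ-no (yes p) ¬p = contradiction p ¬p
  χ-no (no _)  _  = refl

  χ-pos : (P? : Dec P) → 1 ≤ χ P? → P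
  χ-pos (yes p) _ = p
  χ-pos (no _)  ()

  χ-1 : (P? : Dec P) → P → 1 ≤ χ P?
  χ-1 P? p = ≤-reflexive (sym (χ-yes P? p))

  ≤χ : (P? : Dec P) {c : ℕ} → c ≤ 1 → (1 ≤ c → P) → c ≤ χ P?
  ≤χ (yes _) c≤1 _   = c≤1
  ≤χ (no _)  z≤n _   = z≤n
  ≤χ (no ¬p) (s≤s _) pos = contradiction (pos (s≤s z≤n)) ¬p

  χ-diagonal : (P? : Dec P) → χ (P? ×-dec P?) ≡ χ P?
  χ-diagonal (yes _) = refl
  χ-diagonal (no _)  = refl

χ-* : ∀ {P Q : Set} (P? : Dec P) (Q? : Dec Q) → χ P? * χ Q? ≡ χ (P? ×-dec Q?)
χ-* (yes _) (yes _) = refl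
χ-* (yes _) (no _)  = refl
χ-* (no _)  _       = refl

χ-positive : ∀ {d} → d ≤ 1 → χ (1 ≤? d) ≡ d
χ-positive z≤n           = refl
χ-positive (s≤s z≤n)     = refl

count : ∀ {n} {P : Fin n → Set} → (∀ i → Dec (P i)) → ℕ
count {n} P? = ∑[ i < n ] χ (P? i)

module _ {n} {P : Fin n → Set} (P? : ∀ i → Dec (P i)) where

  count≤1 : (∀ i j → P i → P j → i ≡ j) → count P? ≤ 1
  count≤1 unique = sum≤1 _ (χ≤1 ∘ P?)
    (λ i j pᵢ pⱼ → unique i j (χ-pos (P? i) pᵢ) (χ-pos (P? j) pⱼ))

  count≡1 : (∀ i j → P i → P j → i ≡ j) → ∃ P → count P? ≡ 1
  count≡1 unique (i , pᵢ) =
    ≤-antisym (count≤1 unique) (≤-trans (χ-1 (P? i) pᵢ) (term≤sum (χ ∘ P?) i))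

  count-witness : 1 ≤ count P? → ∃ P
  count-witness pos with positive-term (χ ∘ P?) pos
  ... | i , pᵢ = i , χ-pos (P? i) pᵢ

module _ {n} {P : Fin n → Set} (P? : ∀ i → Dec (P i)) where

  ∈-tabulate⁻ : ∀ {i} → i ∈ tabulate (λ j → does (P? j)) → P i
  ∈-tabulate⁻ {i} i∈ with P? i | trans (sym (lookup∘tabulate (λ j → does (P? j)) i)) ([]=⇒lookup i∈)
  ... | yes pᵢ | _ = pᵢ
  ... | no _   | ()

  ∈-tabulate⁺ : ∀ {i} → P i → i ∈ tabulate (λ j → does (P? j))
  ∈-tabulate⁺ {i} pᵢ = lookup⇒[]= i _ (trans (lookup∘tabulate _ i) (isTrue (P? i)))
    where
    isTrue : (d : Dec (P i)) → does d ≡ true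
    isTrue (yes _) = refl
    isTrue (no ¬p) = contradiction pᵢ ¬p

card-tabulate : ∀ {n} {P : Fin n → Set} (P? : ∀ i → Dec (P i)) →
                ∣ tabulate (λ i → does (P? i)) ∣ ≡ count P?
card-tabulate {zero}  P? = refl
card-tabulate {suc n} P? with P? zero
... | yes _ = cong suc (card-tabulate (P? ∘ suc))
... | no _  = card-tabulate (P? ∘ suc)

card-count : ∀ {n} (A : Subset n) → ∣ A ∣ ≡ count (_∈? A)
card-count []          = refl
card-count (true ∷ A)  = cong suc (card-count A)
card-count (false ∷ A) = card-count A

degree-count : ∀ {m n} (B : Fin m → Subset n) x → degree B x ≡ count (λ a → x ∈? B a)
degree-count B x = card-tabulate (λ a → x ∈? B a)

module _ {n} {A : Subset n} where

  card≤1⇒unique : ∣ A ∣ ≤ 1 → ∀ {x y} → x ∈ A → y ∈ A → x ≡ y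
  card≤1⇒unique ∣A∣≤1 {x} {y} x∈A y∈A =
    sum≤1⇒unique _ (subst (_≤ 1) (card-count A) ∣A∣≤1) x y (χ-1 (x ∈? A) x∈A) (χ-1 (y ∈? A) y∈A)

  unique⇒card≤1 : (∀ x y → x ∈ A → y ∈ A → x ≡ y) → ∣ A ∣ ≤ 1
  unique⇒card≤1 unique = subst (_≤ 1) (sym (card-count A)) (count≤1 (_∈? A) unique)

count-with : ∀ {n} (B : Subset n) x → count (λ y → x ∈? B ×-dec y ∈? B) ≡ χ (x ∈? B) * ∣ B ∣
count-with {n} B x = begin
  count (λ y → x ∈? B ×-dec y ∈? B)      ≡⟨ sum-cong-≗ (λ y → sym (χ-* (x ∈? B) (y ∈? B))) ⟩
  ∑[ y < n ] (χ (x ∈? B) * χ (y ∈? B))  ≡⟨ sym (*-distribˡ-sum (χ (x ∈? B)) (λ y → χ (y ∈? B))) ⟩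
  χ (x ∈? B) * count (_∈? B)            ≡⟨ cong (χ (x ∈? B) *_) (sym (card-count B)) ⟩
  χ (x ∈? B) * ∣ B ∣                    ∎
  where open ≡-Reasoning

incidences : ∀ {m n} (B : Fin m → Subset n) → ∑[ a < m ] ∣ B a ∣ ≡ ∑[ x < n ] degree B x
incidences B = trans (sum-cong-≗ (card-count ∘ B))
                 (trans (∑-comm (λ a x → χ (x ∈? B a))) (sum-cong-≗ (sym ∘ degree-count B)))

degree≡1 : ∀ {m n} {B : Fin m → Subset n} {x} →
           (∀ a a' → x ∈ B a → x ∈ B a' → a ≡ a') → (∃ λ a → x ∈ B a) → degree B x ≡ 1
degree≡1 {B = B} {x} unique covered =
  trans (degree-count B x) (count≡1 (λ a → x ∈? B a) unique covered)

partition-size : ∀ {m n k} {B : Fin m → Subset n} →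
                 (∀ x → degree B x ≡ 1) → (∀ a → ∣ B a ∣ ≡ k) → m * k ≡ n
partition-size {m} {n} {k} {B} once size = begin
  m * k                       ≡⟨ sym (sum-const m k) ⟩
  ∑[ a < m ] k                ≡⟨ sum-cong-≗ (sym ∘ size) ⟩
  ∑[ a < m ] ∣ B a ∣          ≡⟨ incidences B ⟩
  ∑[ x < n ] degree B x       ≡⟨ sum-cong-≗ once ⟩
  ∑[ x < n ] 1                ≡⟨ trans (sum-const n 1) (*-identityʳ n) ⟩
  n                           ∎
  where open ≡-Reasoning

enum : ∀ {n} (p : Subset n) → Fin ∣ p ∣ → Fin n
enum (true ∷ p)  zero    = zero
enum (true ∷ p)  (suc j) = suc (enum p j)
enum (false ∷ p) j       = suc (enum p j)

enum-∈ : ∀ {n} (p : Subset n) j → enum p j ∈ p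
enum-∈ (true ∷ p)  zero    = here
enum-∈ (true ∷ p)  (suc j) = there (enum-∈ p j)
enum-∈ (false ∷ p) j       = there (enum-∈ p j)

enum-injective : ∀ {n} (p : Subset n) {j j'} → enum p j ≡ enum p j' → j ≡ j'
enum-injective (true ∷ p)  {zero}  {zero}   _  = refl
enum-injective (true ∷ p)  {suc j} {suc j'} eq =
  cong suc (enum-injective p (sucᶠ-injective eq))
enum-injective (false ∷ p)                  eq = enum-injective p (sucᶠ-injective eq)

enum-surjective : ∀ {n} (p : Subset n) {x} → x ∈ p → ∃ λ j → enum p j ≡ x
enum-surjective (true ∷ p)  here = zero , refl
enum-surjective (true ∷ p)  (there x∈p) with enum-surjective p x∈p
... | j , refl = suc j , refl
enum-surjective (false ∷ p) (there x∈p) with enum-surjective p x∈p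
... | j , refl = j , refl

sum-enum : ∀ {n} (p : Subset n) (f : Fin n → ℕ) →
           ∑[ j < ∣ p ∣ ] f (enum p j) ≡ ∑[ x < n ] (χ (x ∈? p) * f x)
sum-enum []          f = refl
sum-enum (true ∷ p)  f = cong₂ _+_ (sym (+-identityʳ (f zero))) (sum-enum p (f ∘ suc))
sum-enum (false ∷ p) f = sum-enum p (f ∘ suc)

restrict : ∀ {n} (p : Subset n) → Subset n → Subset ∣ p ∣
restrict p B = tabulate (λ j → does (enum p j ∈? B))

module _ {n} {p : Subset n} {B : Subset n} where

  ∈-restrict⁻ : ∀ {j} → j ∈ restrict p B → enum p j ∈ B
  ∈-restrict⁻ = ∈-tabulate⁻ (λ j → enum p j ∈? B)

  ∈-restrict⁺ : ∀ {j} → enum p j ∈ B → j ∈ restrict p B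
  ∈-restrict⁺ = ∈-tabulate⁺ (λ j → enum p j ∈? B)

  restrict-size : B ⊆ p → ∣ restrict p B ∣ ≡ ∣ B ∣
  restrict-size B⊆p = begin
    ∣ restrict p B ∣                         ≡⟨ card-tabulate (λ j → enum p j ∈? B) ⟩
    ∑[ j < ∣ p ∣ ] χ (enum p j ∈? B)          ≡⟨ sum-enum p (λ x → χ (x ∈? B)) ⟩
    ∑[ x < n ] (χ (x ∈? p) * χ (x ∈? B))     ≡⟨ sum-cong-≗ inside ⟩
    count (_∈? B)                            ≡⟨ sym (card-count B) ⟩
    ∣ B ∣                                    ∎
    where
    open ≡-Reasoning
    inside : ∀ x → χ (x ∈? p) * χ (x ∈? B) ≡ χ (x ∈? B)
    inside x with x ∈? B
    ... | yes x∈B = cong (_* 1) (χ-yes (x ∈? p) (B⊆p x∈B))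
    ... | no _    = *-zeroʳ (χ (x ∈? p))

restrict-⊆ : ∀ {n} {p B B' : Subset n} → B ⊆ p → restrict p B ≡ restrict p B' → B ⊆ B'
restrict-⊆ {p = p} B⊆p eq x∈B with enum-surjective p (B⊆p x∈B)
... | j , refl = ∈-restrict⁻ (subst (j ∈_) eq (∈-restrict⁺ x∈B))

restrict-injective : ∀ {n} {p B B' : Subset n} → B ⊆ p → B' ⊆ p →
                     restrict p B ≡ restrict p B' → B ≡ B'
restrict-injective B⊆p B'⊆p eq = ⊆-antisym (restrict-⊆ B⊆p eq) (restrict-⊆ B'⊆p (sym eq))

record ResolvableOn {n} (p : Subset n) (k : ℕ) : Set where
  field
    numBlocks     : ℕ
    block         : Fin numBlocks → Subset n
    within        : ∀ a → block a ⊆ p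
    distinct      : InjectiveFamily block
    blockSize     : ∀ a → ∣ block a ∣ ≡ k
    pairCovered   : ∀ x y → x ∈ p → y ∈ p → x ≢ y → ∃ λ a → x ∈ block a × y ∈ block a
    pairUnique    : ∀ x y → x ≢ y → ∀ a a' →
                    x ∈ block a → y ∈ block a → x ∈ block a' → y ∈ block a' → a ≡ a'
    numClasses    : ℕ
    classOf       : Fin numBlocks → Fin numClasses
    classDisjoint : ∀ (a a' : Fin numBlocks) → classOf a ≡ classOf a' → a ≢ a' →
                    ∀ x → x ∈ block a → x ∈ block a' → ⊥
    classCovers   : ∀ c x → x ∈ p → ∃ λ a → classOf a ≡ c × x ∈ block a

restrictRB : ∀ {n} {p : Subset n} {k} → ResolvableOn p k → RB ∣ p ∣ k
restrictRB {p = p} D = record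
  { numBlocks     = numBlocks
  ; block         = restrict p ∘ block
  ; distinct      = λ a a' eq → distinct a a' (restrict-injective (within a) (within a') eq)
  ; blockSize     = λ a → trans (restrict-size (within a)) (blockSize a)
  ; pairCovered   = covered
  ; pairUnique    = λ i j i≢j a a' ia ja ia' ja' →
      pairUnique (enum p i) (enum p j) (i≢j ∘ enum-injective p) a a'
        (∈-restrict⁻ ia) (∈-restrict⁻ ja) (∈-restrict⁻ ia') (∈-restrict⁻ ja')
  ; numClasses    = numClasses
  ; classOf       = classOf
  ; classDisjoint = λ a a' same a≢a' i ia ia' →
      classDisjoint a a' same a≢a' (enum p i) (∈-restrict⁻ ia) (∈-restrict⁻ ia')
  ; classCovers   = covers
  }
  where
  open ResolvableOn D
  covered : ∀ i j → i ≢ j → ∃ λ a → i ∈ restrict p (block a) × j ∈ restrict p (block a)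
  covered i j i≢j
    with pairCovered (enum p i) (enum p j) (enum-∈ p i) (enum-∈ p j) (i≢j ∘ enum-injective p)
  ... | a , ia , ja = a , ∈-restrict⁺ ia , ∈-restrict⁺ ja
  covers : ∀ c i → ∃ λ a → classOf a ≡ c × i ∈ restrict p (block a)
  covers c i with classCovers c (enum p i) (enum-∈ p i)
  ... | a , same , ia = a , same , ∈-restrict⁺ ia

Linear : ∀ {μ m n} → (Fin μ → Fin m → Subset n) → Set
Linear T = ∀ {x y} → x ≢ y → ∀ {i a j c} →
           x ∈ T i a → y ∈ T i a → x ∈ T j c → y ∈ T j c → (i , a) ≡ (j , c)

module Pencil {μ m n k} (T : Fin μ → Fin m → Subset n) (size : ∀ i a → ∣ T i a ∣ ≡ k)
  (linear : Linear T) (p : Subset n) (inside : ∀ i a → T i a ⊆ p)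
  (x : Fin n) (x∈p : x ∈ p) (once : ∀ i → degree (T i) x ≡ 1) where

  joint : Fin n → ℕ
  joint y = ∑[ i < μ ] count (λ a → x ∈? T i a ×-dec y ∈? T i a)

  -- What joint would be if x were joined to every point of p exactly once.
  expected : Fin n → ℕ
  expected y = χ (y ∈? p) + χ (y ≟ x) * (μ ∸ 1)

  -- Counting incidences block by block: each way contributes its block through x.
  joint-total : ∑[ y < n ] joint y ≡ μ * k
  joint-total = begin
    ∑[ y < n ] ∑[ i < μ ] ∑[ a < m ] χ (x ∈? T i a ×-dec y ∈? T i a)
      ≡⟨ trans (∑-comm (λ y i → ∑[ a < m ] χ (x ∈? T i a ×-dec y ∈? T i a)))
              (sum-cong-≗ (λ i → ∑-comm (λ y a → χ (x ∈? T i a ×-dec y ∈? T i a)))) ⟩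
    ∑[ i < μ ] ∑[ a < m ] count (λ y → x ∈? T i a ×-dec y ∈? T i a)
      ≡⟨ sum-cong-≗ (λ i → sum-cong-≗ (λ a →
           trans (count-with (T i a) x) (cong (χ (x ∈? T i a) *_) (size i a)))) ⟩
    ∑[ i < μ ] ∑[ a < m ] (χ (x ∈? T i a) * k)
      ≡⟨ sum-cong-≗ (λ i → sym (*-distribʳ-sum k (λ a → χ (x ∈? T i a)))) ⟩
    ∑[ i < μ ] (count (λ a → x ∈? T i a) * k)
      ≡⟨ sum-cong-≗ (λ i → cong (_* k) (trans (sym (degree-count (T i) x)) (once i))) ⟩
    ∑[ i < μ ] (1 * k)
      ≡⟨ trans (sum-const μ (1 * k)) (cong (μ *_) (*-identityˡ k)) ⟩
    μ * k ∎
    where open ≡-Reasoning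

  expected-total : ∑[ y < n ] expected y ≡ ∣ p ∣ + (μ ∸ 1)
  expected-total = begin
    ∑[ y < n ] expected y
      ≡⟨ ∑-distrib-+ (λ y → χ (y ∈? p)) (λ y → χ (y ≟ x) * (μ ∸ 1)) ⟩
    count (_∈? p) + ∑[ y < n ] (χ (y ≟ x) * (μ ∸ 1))
      ≡⟨ cong₂ _+_ (sym (card-count p)) (sym (*-distribʳ-sum (μ ∸ 1) (λ y → χ (y ≟ x)))) ⟩
    ∣ p ∣ + count (_≟ x) * (μ ∸ 1)
      ≡⟨ cong (λ c → ∣ p ∣ + c * (μ ∸ 1))
           (count≡1 (_≟ x) (λ y z y≡x z≡x → trans y≡x (sym z≡x)) (x , refl)) ⟩
    ∣ p ∣ + 1 * (μ ∸ 1)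
      ≡⟨ cong (∣ p ∣ +_) (*-identityˡ (μ ∸ 1)) ⟩
    ∣ p ∣ + (μ ∸ 1) ∎
    where open ≡-Reasoning

  joint-self : joint x ≡ μ
  joint-self = begin
    ∑[ i < μ ] count (λ a → x ∈? T i a ×-dec x ∈? T i a)
      ≡⟨ sum-cong-≗ (λ i → trans (sum-cong-≗ (λ a → χ-diagonal (x ∈? T i a)))
                                 (trans (sym (degree-count (T i) x)) (once i))) ⟩
    ∑[ i < μ ] 1
      ≡⟨ trans (sum-const μ 1) (*-identityʳ μ) ⟩
    μ ∎
    where open ≡-Reasoning

  joint-witness : ∀ {y} → 1 ≤ joint y → ∃₂ λ i a → x ∈ T i a × y ∈ T i a
  joint-witness {y} pos with positive-term _ pos
  ... | i , posᵢ with count-witness (λ a → x ∈? T i a ×-dec y ∈? T i a) posᵢ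
  ...   | a , xy∈ = i , a , xy∈

  joint-lower : ∀ {y i a} → x ∈ T i a → y ∈ T i a → 1 ≤ joint y
  joint-lower {y} {i} {a} x∈ y∈ =
    ≤-trans (χ-1 (x ∈? T i a ×-dec y ∈? T i a) (x∈ , y∈))
      (≤-trans (term≤sum _ a) (term≤sum (λ i → count (λ a → x ∈? T i a ×-dec y ∈? T i a)) i))

  -- Linearity: a point y ≠ x is joined to x at most once, and only if y ∈ p.
  joint≤χ : ∀ {y} → y ≢ x → joint y ≤ χ (y ∈? p)
  joint≤χ {y} y≢x =
    ≤χ (y ∈? p) joint≤1 (λ pos → let (i , a , _ , y∈) = joint-witness pos in inside i a y∈)
    where
    x≢y : x ≢ y
    x≢y = y≢x ∘ sym
    joint≤1 : joint y ≤ 1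
    joint≤1 = sum≤1 (λ i → count (λ a → x ∈? T i a ×-dec y ∈? T i a))
      (λ i → count≤1 (λ a → x ∈? T i a ×-dec y ∈? T i a)
               (λ a c (x∈a , y∈a) (x∈c , y∈c) → cong proj₂ (linear x≢y x∈a y∈a x∈c y∈c)))
      (λ i j posᵢ posⱼ →
         let (a , x∈a , y∈a) = count-witness (λ a → x ∈? T i a ×-dec y ∈? T i a) posᵢ
             (c , x∈c , y∈c) = count-witness (λ c → x ∈? T j c ×-dec y ∈? T j c) posⱼ
         in cong proj₁ (linear x≢y x∈a y∈a x∈c y∈c))

  joint≤expected : ∀ y → joint y ≤ expected y
  joint≤expected y with y ≟ x
  ... | yes refl = begin
    joint x                 ≡⟨ joint-self ⟩
    μ                       ≤⟨ m≤n+m∸n μ 1 ⟩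
    1 + (μ ∸ 1)             ≡⟨ cong₂ _+_ (sym (χ-yes (x ∈? p) x∈p)) (sym (*-identityˡ (μ ∸ 1))) ⟩
    χ (x ∈? p) + 1 * (μ ∸ 1) ∎
    where open ≤-Reasoning
  ... | no y≢x = ≤-trans (joint≤χ y≢x) (m≤m+n _ _)

  identity-from-joins : 1 ≤ μ → (∀ y → y ∈ p → y ≢ x → 1 ≤ joint y) → μ * k ≡ ∣ p ∣ + (μ ∸ 1)
  identity-from-joins 1≤μ joins = ≤-antisym
    (begin μ * k                ≡⟨ sym joint-total ⟩
           ∑[ y < n ] joint y    ≤⟨ sum-mono-≤ joint≤expected ⟩
           ∑[ y < n ] expected y ≡⟨ expected-total ⟩
           ∣ p ∣ + (μ ∸ 1)       ∎)
    (begin ∣ p ∣ + (μ ∸ 1)       ≡⟨ sym expected-total ⟩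
           ∑[ y < n ] expected y ≤⟨ sum-mono-≤ expected≤joint ⟩
           ∑[ y < n ] joint y    ≡⟨ joint-total ⟩
           μ * k                ∎)
    where
    open ≤-Reasoning
    expected≤joint : ∀ y → expected y ≤ joint y
    expected≤joint y with y ≟ x
    ... | yes refl = ≤-reflexive (begin-equality
      χ (x ∈? p) + 1 * (μ ∸ 1) ≡⟨ cong₂ _+_ (χ-yes (x ∈? p) x∈p) (*-identityˡ (μ ∸ 1)) ⟩
      1 + (μ ∸ 1)              ≡⟨ m+[n∸m]≡n 1≤μ ⟩
      μ                        ≡⟨ joint-self ⟨
      joint x                  ∎)
    ... | no y≢x with y ∈? p
    ...   | yes y∈p = joins y y∈p y≢x
    ...   | no _    = z≤n

  joins-from-identity : μ * k ≡ ∣ p ∣ + (μ ∸ 1) →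
                        ∀ {y} → y ∈ p → y ≢ x → ∃₂ λ i a → x ∈ T i a × y ∈ T i a
  joins-from-identity identity {y} y∈p y≢x = joint-witness (≤-reflexive (sym joint≡1))
    where
    joint≡1 : joint y ≡ 1
    joint≡1 = trans (sum-tight joint expected joint≤expected
                       (trans joint-total (trans identity (sym expected-total))) y)
                    (cong₂ _+_ (χ-yes (y ∈? p) y∈p) (cong (_* (μ ∸ 1)) (χ-no (y ≟ x) y≢x)))

pencil-arithmetic : ∀ {μ k v} → 1 ≤ μ → 1 ≤ k → 1 ≤ v →
                    μ * (k ∸ 1) ≡ v ∸ 1 ⇔ μ * k ≡ v + (μ ∸ 1)
pencil-arithmetic {suc μ} {suc k} {suc v} _ _ _ = mk⇔ to from
  where
  to : suc μ * k ≡ v → suc μ * suc k ≡ suc v + μ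
  to eq = trans (*-suc (suc μ) k) (cong suc (trans (cong (μ +_) eq) (+-comm μ v)))
  from : suc μ * suc k ≡ suc v + μ → suc μ * k ≡ v
  from eq = +-cancelˡ-≡ μ _ _
    (suc-injective (trans (sym (*-suc (suc μ) k)) (trans eq (cong suc (+-comm v μ)))))

two≤μ : ∀ {μ k v} → 2 ≤ k → k < v → μ * (k ∸ 1) ≡ v ∸ 1 → 2 ≤ μ
two≤μ {suc (suc _)} _ _ _ = s≤s (s≤s z≤n)
two≤μ {zero}     {suc k} {suc v} _ (s≤s k<v) eq = contradiction (subst (k <_) (sym eq) k<v) λ ()
two≤μ {suc zero} {suc k} {suc v} _ (s≤s k<v) eq =
  contradiction k<v (<-irrefl (trans (sym (+-identityʳ k)) eq))
two≤μ {k = zero}           () _  _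
two≤μ {k = suc _} {zero}   _  () _

BalancedCounterpart : ℕ → ℕ → Set
BalancedCounterpart v k = ∃ λ m → ∃ λ μ → m * k ≡ v × μ * (k ∸ 1) ≡ v ∸ 1 ×
                            (∃ λ n → SolelyBalanced1 μ k m n)

module FromResolvable {v k} (R : RB v k) .{{_ : NonZero k}} (2≤k : 2 ≤ k) (k<v : k < v)
  (x₀ x₁ : Fin v) (x₀≢x₁ : x₀ ≢ x₁) where
  open RB R

  parallel-meet : ∀ {a a' x} → classOf a ≡ classOf a' → x ∈ block a → x ∈ block a' → a ≡ a'
  parallel-meet {a} {a'} same x∈a x∈a' =
    decidable-stable (a ≟ a') (λ a≢a' → classDisjoint a a' same a≢a' _ x∈a x∈a')

  classBlocks : Fin numClasses → Subset numBlocks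
  classBlocks c = tabulate (λ a → does (classOf a ≟ c))

  classMember : ∀ c → Fin ∣ classBlocks c ∣ → Fin numBlocks
  classMember c = enum (classBlocks c)

  classMember-class : ∀ {c} j → classOf (classMember c j) ≡ c
  classMember-class {c} j = ∈-tabulate⁻ (λ a → classOf a ≟ c) (enum-∈ (classBlocks c) j)

  classMember-surjective : ∀ a → ∃ λ j → classMember (classOf a) j ≡ a
  classMember-surjective a =
    enum-surjective (classBlocks (classOf a)) (∈-tabulate⁺ (λ b → classOf b ≟ classOf a) refl)

  -- A parallel class partitions the points, so it has v/k blocks.
  class-size : ∀ c → ∣ classBlocks c ∣ * k ≡ v
  class-size c = partition-size {B = block ∘ classMember c} once (blockSize ∘ classMember c)
    where
    once : ∀ x → degree (block ∘ classMember c) x ≡ 1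
    once x = degree≡1
      (λ j j' x∈j x∈j' → enum-injective (classBlocks c)
         (parallel-meet (trans (classMember-class j) (sym (classMember-class j'))) x∈j x∈j'))
      (let (a , a∈c , x∈a) = classCovers c x
           (j , j↦a) = classMember-surjective a
       in subst (λ c → ∃ λ j → x ∈ block (classMember c j)) a∈c
            (j , subst (λ b → x ∈ block b) (sym j↦a) x∈a))

  -- A class (that of a block through x₀ and x₁), whose size m = v/k is shared by all classes.
  c₀ : Fin numClasses
  c₀ = classOf (proj₁ (pairCovered x₀ x₁ x₀≢x₁))

  m : ℕ
  m = ∣ classBlocks c₀ ∣

  classes-agree : ∀ c → m ≡ ∣ classBlocks c ∣
  classes-agree c = *-cancelʳ-≡ m _ k (trans (class-size c₀) (sym (class-size c)))

  member : Fin numClasses → Fin m → Fin numBlocks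
  member c j = classMember c (subst Fin (classes-agree c) j)

  member-class : ∀ {c} j → classOf (member c j) ≡ c
  member-class {c} j = classMember-class (subst Fin (classes-agree c) j)

  member-surjective : ∀ a → ∃ λ j → member (classOf a) j ≡ a
  member-surjective a with classMember-surjective a
  ... | j , j↦a = subst Fin (sym (classes-agree (classOf a))) j
                , trans (cong (classMember (classOf a)) (subst-subst-sym (classes-agree (classOf a)))) j↦a

  member-injective : ∀ {c j c' j'} → member c j ≡ member c' j' → (c , j) ≡ (c' , j')
  member-injective {c} {j} {c'} {j'} eq
    with trans (sym (member-class j)) (trans (cong classOf eq) (member-class j'))
  ... | refl = cong (c ,_) (subst-injective (classes-agree c) (enum-injective (classBlocks c) eq))

  T : Fin numClasses → Fin m → Subset v
  T c j = block (member c j)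

  linear : Linear T
  linear x≢y x∈a y∈a x∈c y∈c = member-injective (pairUnique _ _ x≢y _ _ x∈a y∈a x∈c y∈c)

  steiner : ∀ c x j j' → x ∈ T c j → x ∈ T c j' → j ≡ j'
  steiner c x j j' x∈j x∈j' =
    cong proj₂ (member-injective (parallel-meet (trans (member-class j) (sym (member-class j'))) x∈j x∈j'))

  T-degree : ∀ c x → degree (T c) x ≡ 1
  T-degree c x = degree≡1 (steiner c x)
    (let (a , a∈c , x∈a) = classCovers c x
         (j , j↦a) = member-surjective a
     in subst (λ c → ∃ λ j → x ∈ T c j) a∈c (j , subst (λ b → x ∈ block b) (sym j↦a) x∈a))

  solely : ∀ c c' → c ≢ c' → ∀ j j' → ∣ T c j ∩ T c' j' ∣ ≤ 1
  solely c c' c≢c' j j' = unique⇒card≤1 λ y z y∈ z∈ →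
    decidable-stable (y ≟ z) λ y≢z →
      let (y∈j , y∈j') = x∈p∩q⁻ _ _ y∈
          (z∈j , z∈j') = x∈p∩q⁻ _ _ z∈
      in c≢c' (cong proj₁ (linear y≢z y∈j z∈j y∈j' z∈j'))

  -- The pencil at x₀: x₀ is joined to every other point, giving μ(k-1) = v-1.
  relation : numClasses * (k ∸ 1) ≡ v ∸ 1
  relation = Equivalence.from (pencil-arithmetic 1≤μ 1≤k 1≤v)
    (subst (λ w → numClasses * k ≡ w + (numClasses ∸ 1)) (∣⊤∣≡n v)
      (P.identity-from-joins 1≤μ joins))
    where
    module P = Pencil T (λ c j → blockSize (member c j)) linear
                      ⊤ (λ _ _ _ → ∈⊤) x₀ ∈⊤ (λ c → T-degree c x₀)
    1≤μ : 1 ≤ numClasses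
    1≤μ = >-nonZero⁻¹ numClasses {{nonZeroIndex c₀}}
    1≤k : 1 ≤ k
    1≤k = ≤-trans (s≤s z≤n) 2≤k
    1≤v : 1 ≤ v
    1≤v = ≤-trans (s≤s z≤n) k<v
    joins : ∀ y → y ∈ ⊤ → y ≢ x₀ → 1 ≤ P.joint y
    joins y _ y≢x₀ with pairCovered x₀ y (y≢x₀ ∘ sym)
    ... | a , x₀∈a , y∈a with member-surjective a
    ...   | j , j↦a = P.joint-lower (subst (x₀ ∈_) (cong block (sym j↦a)) x₀∈a)
                                    (subst (y ∈_) (cong block (sym j↦a)) y∈a)

  solelyBalanced : SolelyBalanced1 numClasses k m v
  solelyBalanced = record
    { twoWays   = two≤μ 2≤k k<v relation
    ; kGtT      = 2≤k
    ; T         = T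
    ; blockSize = λ c j → blockSize (member c j)
    ; distinct  = λ c c' j j' eq →
        let e = member-injective (distinct _ _ eq) in cong proj₁ e , cong proj₂ e
    ; balanced  = λ c c' x → trans (T-degree c x) (sym (T-degree c' x))
    ; steiner   = steiner
    ; solely    = solely
    }

-- Forward direction of the theorem (v ≥ 2 provides the points x₀ ≠ x₁).
resolvable⇒solelyBalanced : ∀ {v k} → 2 ≤ k → k < v → RB v k → BalancedCounterpart v k
resolvable⇒solelyBalanced {suc (suc _)} {suc _} 2≤k k<v R =
  m , RB.numClasses R , class-size c₀ , relation , _ , solelyBalanced
  where open FromResolvable R 2≤k k<v zero (suc zero) (λ ())
resolvable⇒solelyBalanced {zero}      _                ()        _
resolvable⇒solelyBalanced {suc zero}  (s≤s (s≤s _))    (s≤s ())  _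

-- From a solely balanced set to a resolvable design on its foundation, given
-- the pencil identity μk = mk + (μ-1) (that is, μ(k-1) = v-1 with v = mk).

module FromSolelyBalanced {μ k m n} (S : SolelyBalanced1 μ k m n)
  (identity : μ * k ≡ m * k + (μ ∸ 1)) where
  open SolelyBalanced1 S

  -- Steiner within a way and solely balanced across ways: the family is linear.
  linear : Linear T
  linear {x} x≢y {i} {a} {j} {c} x∈a y∈a x∈c y∈c with i ≟ j
  ... | yes refl = cong (i ,_) (steiner i x a c x∈a x∈c)
  ... | no i≢j   = contradiction
    (card≤1⇒unique (solely i j i≢j a c) (x∈p∩q⁺ (x∈a , x∈c)) (x∈p∩q⁺ (y∈a , y∈c))) x≢y

  -- A reference way, which exists as μ ≥ 2.
  i₀ : Fin μ
  i₀ with twoWays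
  ... | s≤s _ = zero

  degree≤1 : ∀ i x → degree (T i) x ≤ 1
  degree≤1 i x = subst (_≤ 1) (sym (degree-count (T i) x)) (count≤1 (λ a → x ∈? T i a) (steiner i x))

  -- The foundation: the points covered by the blocks (of any, hence every, way).
  foundation : Subset n
  foundation = tabulate (λ x → does (1 ≤? degree (T i₀) x))

  ∈-foundation : ∀ {i a x} → x ∈ T i a → x ∈ foundation
  ∈-foundation {i} {a} {x} x∈a = ∈-tabulate⁺ (λ x → 1 ≤? degree (T i₀) x)
    (subst (1 ≤_) (balanced i i₀ x)
      (subst (1 ≤_) (sym (degree-count (T i) x)) (≤-trans (χ-1 (x ∈? T i a) x∈a) (term≤sum _ a))))

  foundation-degree : ∀ {x} → x ∈ foundation → ∀ i → degree (T i) x ≡ 1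
  foundation-degree {x} x∈p i = ≤-antisym (degree≤1 i x)
    (subst (1 ≤_) (balanced i₀ i x) (∈-tabulate⁻ (λ x → 1 ≤? degree (T i₀) x) x∈p))

  foundation-covered : ∀ {x} → x ∈ foundation → ∀ i → ∃ λ a → x ∈ T i a
  foundation-covered {x} x∈p i = count-witness (λ a → x ∈? T i a)
    (≤-reflexive (sym (trans (sym (degree-count (T i) x)) (foundation-degree x∈p i))))

  foundation-size : ∣ foundation ∣ ≡ m * k
  foundation-size = begin
    ∣ foundation ∣                     ≡⟨ card-tabulate (λ x → 1 ≤? degree (T i₀) x) ⟩
    ∑[ x < n ] χ (1 ≤? degree (T i₀) x) ≡⟨ sum-cong-≗ (λ x → χ-positive (degree≤1 i₀ x)) ⟩
    ∑[ x < n ] degree (T i₀) x          ≡⟨ sym (incidences (T i₀)) ⟩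
    ∑[ a < m ] ∣ T i₀ a ∣               ≡⟨ sum-cong-≗ (blockSize i₀) ⟩
    ∑[ a < m ] k                       ≡⟨ sum-const m k ⟩
    m * k                              ∎
    where open ≡-Reasoning

  -- Every pair of foundation points is covered, by the pencil identity.
  covered : ∀ {x y} → x ∈ foundation → y ∈ foundation → x ≢ y → ∃₂ λ i a → x ∈ T i a × y ∈ T i a
  covered {x} x∈p y∈p x≢y = P.joins-from-identity
    (trans identity (cong (_+ (μ ∸ 1)) (sym foundation-size))) y∈p (x≢y ∘ sym)
    where
    module P = Pencil T blockSize linear foundation (λ _ _ → ∈-foundation) x x∈p (foundation-degree x∈p)

  -- The blocks, indexed by Fin (μ * m) through (way, position).
  split : Fin (μ * m) → Fin μ × Fin m
  split = remQuot m

  split-injective : ∀ {b b'} → split b ≡ split b' → b ≡ b'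
  split-injective {b} {b'} eq =
    trans (sym (combine-remQuot {μ} m b)) (trans (cong (uncurry combine) eq) (combine-remQuot {μ} m b'))

  blockAt : Fin (μ * m) → Subset n
  blockAt b = uncurry T (split b)

  ∈-blockAt : ∀ {i a x} → x ∈ T i a → x ∈ blockAt (combine i a)
  ∈-blockAt {i} {a} {x} = subst (λ ia → x ∈ uncurry T ia) (sym (remQuot-combine i a))

  design : ResolvableOn foundation k
  design = record
    { numBlocks     = μ * m
    ; block         = blockAt
    ; within        = λ b → ∈-foundation
    ; distinct      = λ b b' eq →
        let (same , same') = distinct _ _ _ _ eq in split-injective (cong₂ _,_ same same')
    ; blockSize     = λ b → blockSize _ _
    ; pairCovered   = λ x y x∈p y∈p x≢y → let (i , a , x∈a , y∈a) = covered x∈p y∈p x≢y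
                                         in combine i a , ∈-blockAt x∈a , ∈-blockAt y∈a
    ; pairUnique    = λ x y x≢y b b' x∈b y∈b x∈b' y∈b' → split-injective (linear x≢y x∈b y∈b x∈b' y∈b')
    ; numClasses    = μ
    ; classOf       = proj₁ ∘ split
    ; classDisjoint = λ b b' same b≢b' x x∈b x∈b' → b≢b' (split-injective (cong₂ _,_ same
                        (steiner _ x _ _ (subst (λ i → x ∈ T i (proj₂ (split b))) same x∈b) x∈b')))
    ; classCovers   = λ c x x∈p → let (a , x∈a) = foundation-covered x∈p c
                                 in combine c a , cong proj₁ (remQuot-combine c a) , ∈-blockAt x∈a
    }

solelyBalanced⇒resolvable : ∀ {v k} → k < v → BalancedCounterpart v k → RB v k
solelyBalanced⇒resolvable {k = k} k<v (m , μ , mk≡v , relation , n , S) =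
  subst (λ w → RB w k) (trans foundation-size mk≡v) (restrictRB design)
  where
  1≤k : 1 ≤ k
  1≤k = ≤-trans (s≤s z≤n) (SolelyBalanced1.kGtT S)
  1≤μ : 1 ≤ μ
  1≤μ = ≤-trans (s≤s z≤n) (SolelyBalanced1.twoWays S)
  identity : μ * k ≡ m * k + (μ ∸ 1)
  identity = subst (λ w → μ * k ≡ w + (μ ∸ 1)) (sym mk≡v)
    (Equivalence.to (pencil-arithmetic 1≤μ 1≤k (≤-trans (s≤s z≤n) k<v)) relation)
  open FromSolelyBalanced S identity

mainTheorem1 : ∀ (v k : ℕ) → 2 ≤ k → k < v →
    RB v k ⇔ (∃ λ m → ∃ λ μ → m * k ≡ v × μ * (k ∸ 1) ≡ v ∸ 1 ×
                (∃ λ n → SolelyBalanced1 μ k m n))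
mainTheorem1 v k 2≤k k<v = mk⇔ (resolvable⇒solelyBalanced 2≤k k<v) (solelyBalanced⇒resolvable k<v)
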